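{- For $n\ge 2$, the star $K_{1,n}$ satisfies $\nu^*(K_{1,n})=\frac{5n^2+n}{2}$.
   Context: For a finite simple graph $G=(V,E)$ with $p=|V|$, $q=|E|$, $\ell=p+q$, a construction sequence (c-sequence) for $G$ is a bijection $x:\{1,\dots,\ell\}\to V\sqcup E$ such that for every edge $e=uw$, $x^{ -1}(e)>\max\{x^{ -1}(u),x^{ -1}(w)\}$. The cost of an edge $e=uw$ in $x$ is $\nu(e,x)=(x^{ -1}(e)-x^{ -1}(u))+(x^{ -1}(e)-x^{ -1}(w))$, and the cost of $x$ is $\nu(x)=\sum_{e\in E}\nu(e,x)$. The max cost of $G$ is $\nu^*(G)=\max\nu(x)$ over all c-sequences $x$ for $G$. $K_{1,n}$ is the star with one hub adjacent to $n$ leaves. -}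

module Defs where

open import Data.Nat using (ℕ; zero; suc; _+_; _∸_; _<_; _≤_)
open import Data.Fin using (Fin; toℕ)
import Data.Fin as F
open import Data.Sum using (_⊎_; inj₁; inj₂)
open import Data.Product using (_×_; _,_; proj₁; proj₂; Σ; ∃)
open import Data.List using (tabulate)
open import Data.Nat.ListAction using (sum)
open import Relation.Binary.PropositionalEquality using (_≡_)
open import Relation.Nullary using (¬_)
open import Function.Bundles using (_↔_; Inverse)

record SimpleGraph : Set where
  field
    p : ℕ
    q : ℕ
    ends : Fin q → Fin p × Fin p
    noLoop : ∀ e → ¬ (proj₁ (ends e) ≡ proj₂ (ends e))
    noMulti : ∀ e f → ( (proj₁ (ends e) ≡ proj₁ (ends f) × proj₂ (ends e) ≡ proj₂ (ends f))
                      ⊎ (proj₁ (ends e) ≡ proj₂ (ends f) × proj₂ (ends e) ≡ proj₁ (ends f)) )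
                    → e ≡ f

open SimpleGraph public

Elem : SimpleGraph → Set
Elem G = Fin (p G) ⊎ Fin (q G)

len : SimpleGraph → ℕ
len G = p G + q G

-- A construction sequence: a bijection x : {1..ℓ} → V ⊔ E (positions are
-- 0-based here, which does not affect differences of positions) such that
-- every edge comes after both of its endpoints.
record CSeq (G : SimpleGraph) : Set where
  field
    x : Fin (len G) ↔ Elem G
  pos : Elem G → ℕ
  pos a = toℕ (Inverse.from x a)
  field
    edgeAfter : ∀ e → pos (inj₁ (proj₁ (ends G e))) < pos (inj₂ e)
                    × pos (inj₁ (proj₂ (ends G e))) < pos (inj₂ e)

open CSeq public

edgeCost : {G : SimpleGraph} → CSeq G → Fin (q G) → ℕ
edgeCost {G} s e = (pos s (inj₂ e) ∸ pos s (inj₁ (proj₁ (ends G e))))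
                 + (pos s (inj₂ e) ∸ pos s (inj₁ (proj₂ (ends G e))))

cost : {G : SimpleGraph} → CSeq G → ℕ
cost {G} s = sum (tabulate (edgeCost s))

IsMaxCost : SimpleGraph → ℕ → Set
IsMaxCost G N = (∃ λ (s : CSeq G) → cost s ≡ N) × (∀ (s : CSeq G) → cost s ≤ N)

starEnds : (n : ℕ) → Fin n → Fin (suc n) × Fin (suc n)
starEnds n i = F.zero , F.suc i

private
  0≢suc : ∀ {n} {i : Fin n} → ¬ (F.zero ≡ F.suc i)
  0≢suc ()

  suc-inj : ∀ {n} {i j : Fin n} → F.suc i ≡ F.suc j → i ≡ j
  suc-inj Relation.Binary.PropositionalEquality.refl = Relation.Binary.PropositionalEquality.refl

  starNoMulti : (n : ℕ) → ∀ (e f : Fin n) →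
    ((F.zero {n} ≡ F.zero × F.suc e ≡ F.suc f) ⊎ (F.zero ≡ F.suc f × F.suc e ≡ F.zero)) → e ≡ f
  starNoMulti n e f (inj₁ (_ , h)) = suc-inj h
  starNoMulti n e f (inj₂ (() , _))

K1 : ℕ → SimpleGraph
K1 n = record
  { p = suc n
  ; q = n
  ; ends = starEnds n
  ; noLoop = λ e → 0≢suc
  ; noMulti = starNoMulti n
  }

-- A c-sequence of K₁,ₙ occupies positions 0,…,2n. Summing the edge costs gives
--   ν(x) = 2·Σ(edge positions) − n·(hub position) − Σ(leaf positions).
-- The n edges occupy n distinct positions, so their sum is at most the sum of the n
-- largest ones; the n+1 vertices occupy distinct positions, so their sum is at least
-- 0+1+⋯+n, and n·(hub) ≥ hub. These two extremal sums give ν(x) ≤ (5n²+n)/2, with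
-- equality for the sequence that lists all vertices (hub first) before all edges.
module Submission where

open import Defs
open import Data.Nat.Properties
open import Algebra.Properties.CommutativeMonoid.Sum +-0-commutativeMonoid
  using (sum; sum-syntax; sum-cong-≗; sum-remove; ∑-distrib-+)
open import Algebra.Properties.CommutativeSemigroup +-commutativeSemigroup
  using (interchange; xy∙z≈xz∙y)
open import Data.Fin using (Fin; toℕ; lower₁; punchIn; opposite; _↑ˡ_; _↑ʳ_)
import Data.Fin as F
open import Data.Fin.Properties
  using (any?; injective⇒≤; lower₁-injective; toℕ-lower₁; punchIn-injective; punchInᵢ≢i;
         toℕ-injective; opposite-prop; opposite-involutive; toℕ<n; +↔⊎; toℕ-↑ˡ; toℕ-↑ʳ)
open import Data.List using (tabulate)
import Data.Nat.ListAction as List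
open import Data.Nat using (ℕ; zero; suc; _+_; _*_; _/_; _∸_; _≤_; _<_; NonZero; z≤n; s≤s; s≤s⁻¹)
open import Data.Nat.DivMod using (m*n/n≡m)
open import Data.Nat.Tactic.RingSolver using (solve-∀)
open import Data.Product using (_,_; proj₁; proj₂)
open import Data.Sum using (inj₁; inj₂)
open import Data.Sum.Properties using (inj₁-injective; inj₂-injective)
open import Function using (_∘_; _↔_; Injective; Inverse)
open import Function.Bundles using (Injection)
open import Function.Properties.Inverse using (↔⇒↣; ↔-sym)
open import Relation.Binary.PropositionalEquality
open import Relation.Nullary using (yes; no)

sum-tabulate : ∀ {k} (f : Fin k → ℕ) → List.sum (tabulate f) ≡ sum f
sum-tabulate {zero}  f = refl
sum-tabulate {suc k} f = cong (f F.zero +_) (sum-tabulate (f ∘ F.suc))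

∑-const : ∀ k c → ∑[ i < k ] c ≡ k * c
∑-const zero    c = refl
∑-const (suc k) c = cong (c +_) (∑-const k c)

triangular : ℕ → ℕ
triangular zero    = 0
triangular (suc k) = k + triangular k

triangular-double : ∀ k → 2 * triangular k + k ≡ k * k
triangular-double zero    = refl
triangular-double (suc k) = begin
  2 * (k + t) + suc k           ≡⟨ regroup k t ⟩
  2 * k + suc (2 * t + k)       ≡⟨ cong (λ z → 2 * k + suc z) (triangular-double k) ⟩
  2 * k + suc (k * k)           ≡⟨ square-suc k ⟩
  suc k * suc k                 ∎
  where
  open ≡-Reasoning
  t = triangular k
  regroup : ∀ k t → 2 * (k + t) + suc k ≡ 2 * k + suc (2 * t + k)
  regroup = solve-∀
  square-suc : ∀ k → 2 * k + suc (k * k) ≡ suc k * suc k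
  square-suc = solve-∀

∑-toℕ : ∀ k → ∑[ i < k ] toℕ i ≡ triangular k
∑-toℕ zero    = refl
∑-toℕ (suc k) = begin
  ∑[ i < k ] (1 + toℕ i)            ≡⟨ ∑-distrib-+ {k} (λ _ → 1) toℕ ⟩
  ∑[ i < k ] 1 + ∑[ i < k ] toℕ i   ≡⟨ cong₂ _+_ (trans (∑-const k 1) (*-identityʳ k)) (∑-toℕ k) ⟩
  k + triangular k                  ∎
  where open ≡-Reasoning

triangular≤∑toℕ : ∀ {k} m (f : Fin k → Fin m) → Injective _≡_ _≡_ f →
                  triangular k ≤ ∑[ i < k ] toℕ (f i)
triangular≤∑toℕ-missing : ∀ {k} m (f : Fin k → Fin (suc m)) → Injective _≡_ _≡_ f →
                          (∀ i → m ≢ toℕ (f i)) → triangular k ≤ ∑[ i < k ] toℕ (f i)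

-- Induction on the codomain: if the top value m is taken, remove its preimage, which
-- contributes m ≥ k; in any case the rest lands in Fin m.
triangular≤∑toℕ {zero}  _       _ _ = z≤n
triangular≤∑toℕ {suc k} zero    f _ with f F.zero
... | ()
triangular≤∑toℕ {suc k} (suc m) f f-inj with any? (λ i → m ≟ toℕ (f i))
... | no  m∉f          = triangular≤∑toℕ-missing m f f-inj (λ i m≡fi → m∉f (i , m≡fi))
... | yes (i , m≡fi) = begin
  k + triangular k                    ≤⟨ +-mono-≤ k≤m (triangular≤∑toℕ-missing m g g-inj g-misses) ⟩
  m + ∑[ j < k ] toℕ (g j)            ≡⟨ cong (_+ ∑[ j < k ] toℕ (g j)) m≡fi ⟩
  toℕ (f i) + ∑[ j < k ] toℕ (g j)    ≡⟨ sum-remove (toℕ ∘ f) ⟨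
  ∑[ j < suc k ] toℕ (f j)            ∎
  where
  open ≤-Reasoning
  g : Fin k → Fin (suc m)
  g = f ∘ punchIn i
  g-inj : Injective _≡_ _≡_ g
  g-inj = punchIn-injective i _ _ ∘ f-inj
  g-misses : ∀ j → m ≢ toℕ (g j)
  g-misses j m≡gj = punchInᵢ≢i i j (f-inj (toℕ-injective (trans (sym m≡gj) m≡fi)))
  k≤m : k ≤ m
  k≤m = s≤s⁻¹ (injective⇒≤ f-inj)

triangular≤∑toℕ-missing {k} m f f-inj m∉f = begin
  triangular k            ≤⟨ triangular≤∑toℕ m f′ (f-inj ∘ lower₁-injective) ⟩
  ∑[ i < k ] toℕ (f′ i)   ≡⟨ sum-cong-≗ (λ i → toℕ-lower₁ (f i) (m∉f i)) ⟩
  ∑[ i < k ] toℕ (f i)    ∎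
  where
  open ≤-Reasoning
  f′ : Fin k → Fin m
  f′ i = lower₁ (f i) (m∉f i)

∑toℕ+triangular≤ : ∀ {k} m (f : Fin k → Fin (suc m)) → Injective _≡_ _≡_ f →
                   ∑[ i < k ] toℕ (f i) + triangular k ≤ k * m
∑toℕ+triangular≤ {k} m f f-inj = begin
  ∑[ i < k ] toℕ (f i) + triangular k                       ≤⟨ +-monoʳ-≤ _ (triangular≤∑toℕ (suc m) f̄ f̄-inj) ⟩
  ∑[ i < k ] toℕ (f i) + ∑[ i < k ] toℕ (f̄ i)               ≡⟨ ∑-distrib-+ (toℕ ∘ f) (toℕ ∘ f̄) ⟨
  ∑[ i < k ] (toℕ (f i) + toℕ (f̄ i))                        ≡⟨ sum-cong-≗ (toℕ+toℕ-opposite ∘ f) ⟩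
  ∑[ i < k ] m                                              ≡⟨ ∑-const k m ⟩
  k * m                                                     ∎
  where
  open ≤-Reasoning
  f̄ : Fin k → Fin (suc m)
  f̄ = opposite ∘ f
  f̄-inj : Injective _≡_ _≡_ f̄
  f̄-inj eq = f-inj (trans (sym (opposite-involutive _))
                    (trans (cong opposite eq) (opposite-involutive _)))
  toℕ+toℕ-opposite : ∀ (i : Fin (suc m)) → toℕ i + toℕ (opposite i) ≡ m
  toℕ+toℕ-opposite i = trans (cong (toℕ i +_) (opposite-prop i)) (m+[n∸m]≡n (s≤s⁻¹ (toℕ<n i)))

[m∸n]+[m∸o]+[n+o]≡m+m : ∀ {m n o} → n ≤ m → o ≤ m → (m ∸ n) + (m ∸ o) + (n + o) ≡ m + m
[m∸n]+[m∸o]+[n+o]≡m+m {m} {n} {o} n≤m o≤m = begin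
  (m ∸ n) + (m ∸ o) + (n + o)   ≡⟨ interchange (m ∸ n) (m ∸ o) n o ⟩
  (m ∸ n + n) + (m ∸ o + o)     ≡⟨ cong₂ _+_ (m∸n+n≡m n≤m) (m∸n+n≡m o≤m) ⟩
  m + m                         ∎
  where open ≡-Reasoning

cost+∑endpoints≡∑edges+∑edges :
  ∀ {G} (s : CSeq G) →
  cost s + ∑[ e < q G ] (pos s (inj₁ (proj₁ (ends G e))) + pos s (inj₁ (proj₂ (ends G e))))
    ≡ ∑[ e < q G ] pos s (inj₂ e) + ∑[ e < q G ] pos s (inj₂ e)
cost+∑endpoints≡∑edges+∑edges {G} s = begin
  cost s + ∑[ e < q G ] endpoints e                  ≡⟨ cong (_+ ∑[ e < q G ] endpoints e) (sum-tabulate (edgeCost s)) ⟩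
  ∑[ e < q G ] edgeCost s e + ∑[ e < q G ] endpoints e ≡⟨ ∑-distrib-+ (edgeCost s) endpoints ⟨
  ∑[ e < q G ] (edgeCost s e + endpoints e)           ≡⟨ sum-cong-≗ edgeCost+endpoints ⟩
  ∑[ e < q G ] (edgePos e + edgePos e)                ≡⟨ ∑-distrib-+ edgePos edgePos ⟩
  ∑[ e < q G ] edgePos e + ∑[ e < q G ] edgePos e     ∎
  where
  open ≡-Reasoning
  edgePos : Fin (q G) → ℕ
  edgePos e = pos s (inj₂ e)
  endpoints : Fin (q G) → ℕ
  endpoints e = pos s (inj₁ (proj₁ (ends G e))) + pos s (inj₁ (proj₂ (ends G e)))
  edgeCost+endpoints : ∀ e → edgeCost s e + endpoints e ≡ edgePos e + edgePos e
  edgeCost+endpoints e =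
    [m∸n]+[m∸o]+[n+o]≡m+m (<⇒≤ (proj₁ (edgeAfter s e))) (<⇒≤ (proj₂ (edgeAfter s e)))

from-injective : ∀ {A B : Set} (x : A ↔ B) → Injective _≡_ _≡_ (Inverse.from x)
from-injective x = Injection.injective (↔⇒↣ (↔-sym x))

starMaxCost : ℕ → ℕ
starMaxCost n = n * (suc n + n) + triangular n

starMaxCost*2 : ∀ n → starMaxCost n * 2 ≡ 5 * (n * n) + n
starMaxCost*2 n = begin
  (n * (suc n + n) + t) * 2        ≡⟨ expand n t ⟩
  4 * (n * n) + (2 * t + n) + n    ≡⟨ cong (λ z → 4 * (n * n) + z + n) (triangular-double n) ⟩
  4 * (n * n) + n * n + n          ≡⟨ collect n ⟩
  5 * (n * n) + n                  ∎
  where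
  open ≡-Reasoning
  t = triangular n
  expand : ∀ n t → (n * (suc n + n) + t) * 2 ≡ 4 * (n * n) + (2 * t + n) + n
  expand = solve-∀
  collect : ∀ n → 4 * (n * n) + n * n + n ≡ 5 * (n * n) + n
  collect = solve-∀

starMaxCost+slack : ∀ n → let t = triangular n in
                    starMaxCost n + (n + t + (t + t)) ≡ n * (n + n) + n * (n + n)
starMaxCost+slack n = begin
  n * (suc n + n) + t + (n + t + (t + t))    ≡⟨ expand n t ⟩
  2 * (n * n) + 2 * (2 * t + n)              ≡⟨ cong (λ z → 2 * (n * n) + 2 * z) (triangular-double n) ⟩
  2 * (n * n) + 2 * (n * n)                  ≡⟨ collect n ⟩
  n * (n + n) + n * (n + n)                  ∎
  where
  open ≡-Reasoning
  t = triangular n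
  expand : ∀ n t → n * (suc n + n) + t + (n + t + (t + t)) ≡ 2 * (n * n) + 2 * (2 * t + n)
  expand = solve-∀
  collect : ∀ n → 2 * (n * n) + 2 * (n * n) ≡ n * (n + n) + n * (n + n)
  collect = solve-∀

cost-K1≤starMaxCost : ∀ n .{{_ : NonZero n}} (s : CSeq (K1 n)) → cost s ≤ starMaxCost n
cost-K1≤starMaxCost n s = +-cancelʳ-≤ (n + t + (t + t)) (cost s) (starMaxCost n) (begin
  cost s + (n + t + (t + t))       ≡⟨ +-assoc (cost s) (n + t) (t + t) ⟨
  cost s + (n + t) + (t + t)       ≤⟨ +-monoˡ-≤ (t + t) vertices ⟩
  E + E + (t + t)                  ≡⟨ interchange E E t t ⟩
  (E + t) + (E + t)                ≤⟨ +-mono-≤ edges edges ⟩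
  n * (n + n) + n * (n + n)        ≡⟨ starMaxCost+slack n ⟨
  starMaxCost n + (n + t + (t + t)) ∎)
  where
  open ≤-Reasoning
  t = triangular n
  slot : Elem (K1 n) → Fin (len (K1 n))
  slot = Inverse.from (x s)
  h = pos s (inj₁ F.zero)
  leaf : Fin n → ℕ
  leaf e = pos s (inj₁ (F.suc e))
  L = ∑[ e < n ] leaf e
  E = ∑[ e < n ] pos s (inj₂ e)
  edges : E + t ≤ n * (n + n)
  edges = ∑toℕ+triangular≤ (n + n) (slot ∘ inj₂) (inj₂-injective ∘ from-injective (x s))
  vertices : cost s + (n + t) ≤ E + E
  vertices = begin
    cost s + (n + t)                  ≤⟨ +-monoʳ-≤ (cost s) (triangular≤∑toℕ (suc (n + n)) (slot ∘ inj₁)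
                                                              (inj₁-injective ∘ from-injective (x s))) ⟩
    cost s + (h + L)                  ≤⟨ +-monoʳ-≤ (cost s) (+-monoˡ-≤ L (m≤n*m h n)) ⟩
    cost s + (n * h + L)              ≡⟨ cong (λ z → cost s + (z + L)) (∑-const n h) ⟨
    cost s + (∑[ e < n ] h + L)       ≡⟨ cong (cost s +_) (∑-distrib-+ (λ _ → h) leaf) ⟨
    cost s + ∑[ e < n ] (h + leaf e)  ≡⟨ cost+∑endpoints≡∑edges+∑edges s ⟩
    E + E                             ∎

verticesFirst : ∀ n → CSeq (K1 n)
verticesFirst n = record { x = +↔⊎ ; edgeAfter = λ e → hub<edge e , leaf<edge e }
  where
  hub<edge : ∀ e → 0 < toℕ (suc n ↑ʳ e)
  hub<edge e = subst (0 <_) (sym (toℕ-↑ʳ (suc n) e)) (s≤s z≤n)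
  leaf<edge : ∀ e → toℕ (F.suc e ↑ˡ n) < toℕ (suc n ↑ʳ e)
  leaf<edge e = subst₂ _<_ (sym (toℕ-↑ˡ (F.suc e) n)) (sym (toℕ-↑ʳ (suc n) e))
                  (s≤s (≤-trans (toℕ<n e) (m≤m+n n (toℕ e))))

cost-verticesFirst : ∀ n → cost (verticesFirst n) ≡ starMaxCost n
cost-verticesFirst n = begin
  cost (verticesFirst n)                            ≡⟨ sum-tabulate (edgeCost (verticesFirst n)) ⟩
  ∑[ e < n ] edgeCost (verticesFirst n) e           ≡⟨ sum-cong-≗ edgeCost-verticesFirst ⟩
  ∑[ e < n ] (suc n + n + toℕ e)                    ≡⟨ ∑-distrib-+ {n} (λ _ → suc n + n) toℕ ⟩
  ∑[ e < n ] (suc n + n) + ∑[ e < n ] toℕ e         ≡⟨ cong₂ _+_ (∑-const n (suc n + n)) (∑-toℕ n) ⟩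
  starMaxCost n                                     ∎
  where
  open ≡-Reasoning
  edgeCost-verticesFirst : ∀ e → edgeCost (verticesFirst n) e ≡ suc n + n + toℕ e
  edgeCost-verticesFirst e = begin
    (toℕ (suc n ↑ʳ e) ∸ 0) + (toℕ (suc n ↑ʳ e) ∸ toℕ (F.suc e ↑ˡ n))
      ≡⟨ cong₂ (λ a b → a + (a ∸ b)) (toℕ-↑ʳ (suc n) e) (toℕ-↑ˡ (F.suc e) n) ⟩
    suc n + toℕ e + (n + toℕ e ∸ toℕ e)
      ≡⟨ cong (suc n + toℕ e +_) (m+n∸n≡m n (toℕ e)) ⟩
    suc n + toℕ e + n
      ≡⟨ xy∙z≈xz∙y (suc n) (toℕ e) n ⟩
    suc n + n + toℕ e ∎

theorem2 : ∀ (n : ℕ) → 2 ≤ n → IsMaxCost (K1 n) ((5 * (n * n) + n) / 2)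
theorem2 n@(suc _) _ = subst (IsMaxCost (K1 n)) (sym maxCost≡)
  ((verticesFirst n , cost-verticesFirst n) , cost-K1≤starMaxCost n)
  where
  maxCost≡ : (5 * (n * n) + n) / 2 ≡ starMaxCost n
  maxCost≡ = trans (cong (_/ 2) (sym (starMaxCost*2 n))) (m*n/n≡m (starMaxCost n) 2)
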